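{- Let $T$ be the $\tilde{\mathcal L}$-theory described below. There is a unique (up to isomorphism) model $\mathcal C\vDash T$ whose domain equals the set of interpretations of the constants in $C$, i.e. every element of $\mathcal C$ is the interpretation of a constant. Moreover, $\mathcal C$ embeds into every model of $T$.
   Context: Let $\mathcal L_0=\{P_i: i\in\omega\}\cup\{<_i:i\in\omega\}$ with $P_i$ unary and $<_i$ binary relation symbols. Let $T_0$ be the $\mathcal L_0$-theory with axioms: for all $i\neq j$, $\neg\exists x(P_i(x)\wedge P_j(x))$; and for all $i$: $\forall x\forall y(x<_i y\to P_i(x)\wedge P_{i+1}(y))$; $\forall x(P_{i+1}(x)\to\exists y(P_i(y)\wedge y<_i x))$; $\forall x\forall x'\forall y((x<_i y\wedge x'<_i y)\to x=x')$. Let $(\mathcal M_i)_{i<\omega}$ list without repetition representatives of all isomorphism types of finite models of $T_0$. For each $i,j\in\omega$ let $C_i^j$ be a set of $|M_i|$ new constant symbols (all these sets pairwise disjoint) and fix a bijection $e_i^j:C_i^j\to M_i$. Let $C=\bigcup_{i,j}C_i^j$ and $\tilde{\mathcal L}=\mathcal L_0\cup C$. $T$ is the $\tilde{\mathcal L}$-theory consisting of: $T_0$; $c\neq d$ for all distinct $c,d\in C$; for each $i,j$, all atomic and negated atomic $\mathcal L_0$-sentences about constants in $C_i^j$ that hold in $\mathcal M_i$ of the corresponding elements under $e_i^j$ (so the substructure on the interpretations of $C_i^j$ is isomorphic to $\mathcal M_i$); and for each $i,j,k$: $\forall x\forall y\big((\bigvee_{c\in C_i^j}x=c)\wedge(x<_k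 y\vee y<_k x)\to\bigvee_{c\in C_i^j}y=c\big)$. -}

module Defs where

open import Level using (Level)
open import Data.Nat using (ℕ; suc)
open import Data.Fin using (Fin)
open import Data.Product using (Σ; Σ-syntax; _×_; _,_)
open import Data.Sum using (_⊎_)
open import Relation.Nullary using (¬_)
open import Relation.Binary.PropositionalEquality using (_≡_; _≢_)
open import Function.Bundles using (_⇔_; _↔_)
open import Function.Definitions using (Injective; Surjective)

record L0Str : Set₁ where
  field
    Carrier : Set
    P  : ℕ → Carrier → Set
    Lt : ℕ → Carrier → Carrier → Set
open L0Str public

record IsModelT0 (A : L0Str) : Set where
  field
    disjoint : ∀ i j → i ≢ j → ¬ (Σ[ x ∈ Carrier A ] (P A i x × P A j x))
    typed    : ∀ i x y → Lt A i x y → P A i x × P A (suc i) y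
    hasPred  : ∀ i x → P A (suc i) x → Σ[ y ∈ Carrier A ] (P A i y × Lt A i y x)
    uniqPred : ∀ i x x' y → Lt A i x y → Lt A i x' y → x ≡ x'

record L0Iso (A B : L0Str) : Set where
  field
    bij   : Carrier A ↔ Carrier B
  open Function.Bundles.Inverse bij public using (to)
  field
    presP  : ∀ k x → P A k x ⇔ P B k (to x)
    presLt : ∀ k x y → Lt A k x y ⇔ Lt B k (to x) (to y)

record FinModel : Set₁ where
  field
    str   : L0Str
    model : IsModelT0 str
    size  : ℕ
    fin   : Carrier str ↔ Fin size
open FinModel public

IsEnumeration : (ℕ → FinModel) → Set₁
IsEnumeration M =
  (∀ (N : FinModel) → Σ[ i ∈ ℕ ] L0Iso (str N) (str (M i))) ×
  (∀ i j → L0Iso (str (M i)) (str (M j)) → i ≡ j)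

-- The constants: C = ⋃_{i,j} C_i^j, where C_i^j is identified (via e_i^j)
-- with the domain of M i.  A constant is thus a triple (i , j , a), a ∈ M i.
Const : (ℕ → FinModel) → Set
Const M = Σ[ i ∈ ℕ ] (ℕ × Carrier (str (M i)))

record LStr (M : ℕ → FinModel) : Set₁ where
  field
    base   : L0Str
    interp : Const M → Carrier base
open LStr public

record IsModelT (M : ℕ → FinModel) (A : LStr M) : Set where
  field
    t0       : IsModelT0 (base A)
    distinct : ∀ c d → c ≢ d → interp A c ≢ interp A d
    diagP    : ∀ i j k a → P (base A) k (interp A (i , j , a)) ⇔ P (str (M i)) k a
    diagLt   : ∀ i j k a b →
               Lt (base A) k (interp A (i , j , a)) (interp A (i , j , b)) ⇔ Lt (str (M i)) k a b
    closed   : ∀ i j k a y →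
               (Lt (base A) k (interp A (i , j , a)) y ⊎ Lt (base A) k y (interp A (i , j , a))) →
               Σ[ b ∈ Carrier (str (M i)) ] y ≡ interp A (i , j , b)

AllNamed : {M : ℕ → FinModel} → LStr M → Set
AllNamed A = Surjective _≡_ _≡_ (interp A)

record LIso {M : ℕ → FinModel} (A B : LStr M) : Set where
  field
    iso    : L0Iso (base A) (base B)
    presC  : ∀ c → L0Iso.to iso (interp A c) ≡ interp B c

record LEmb {M : ℕ → FinModel} (A B : LStr M) : Set where
  field
    f      : Carrier (base A) → Carrier (base B)
    inj    : Injective _≡_ _≡_ f
    presP  : ∀ k x → P (base A) k x ⇔ P (base B) k (f x)
    presLt : ∀ k x y → Lt (base A) k x y ⇔ Lt (base B) k (f x) (f y)
    presC  : ∀ c → f (interp A c) ≡ interp B c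

-- The constants themselves, with P and <ₖ read off the copy of Mᵢ they name, form a
-- model 𝒞 of T: each Cᵢʲ carries a copy of Mᵢ and no <ₖ-edge joins different copies.
-- In any model D of T the interpretation map 𝒞 → D is injective (distinct constants
-- denote distinct elements, and equality of constants is decidable), preserves P and
-- <ₖ by the diagram axioms, and reflects <ₖ because the copies are <ₖ-closed in D.
-- So it is an embedding, and an isomorphism when every element of D is named.
module Submission where

open import Defs
open import Data.Nat using (ℕ)
import Data.Nat.Properties as ℕ
open import Data.Fin.Properties using () renaming (_≟_ to _≟ᶠ_)
open import Data.Product using (Σ; Σ-syntax; _×_; _,_)
open import Data.Product.Properties using (≡-dec)
open import Data.Sum using (inj₁; inj₂)
open import Function.Bundles using (_⇔_; mk⇔; mk⤖; Equivalence)
open import Function.Definitions using (Injective; Surjective)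
open import Function.Properties.Bijection using (Bijection⇒Inverse)
open import Function.Properties.Equivalence using () renaming (sym to ⇔-sym)
open import Function.Properties.Inverse using (↔⇒↣)
open import Relation.Binary.Definitions using (DecidableEquality)
open import Relation.Binary.PropositionalEquality using (_≡_; _≢_; refl; cong)
open import Relation.Nullary.Decidable using (via-injection; decidable-stable)

≢-preserving⇒injective : {A B : Set} {f : A → B} → DecidableEquality A →
                         (∀ x y → x ≢ y → f x ≢ f y) → Injective _≡_ _≡_ f
≢-preserving⇒injective _≟_ pres {x} {y} fx≡fy =
  decidable-stable (x ≟ y) (λ x≢y → pres x y x≢y fx≡fy)

LEmb⇒LIso : {M : ℕ → FinModel} {A B : LStr M} (e : LEmb A B) →
            Surjective _≡_ _≡_ (LEmb.f e) → LIso A B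
LEmb⇒LIso e surj = record
  { iso = record
    { bij    = Bijection⇒Inverse (mk⤖ (LEmb.inj e , surj))
    ; presP  = LEmb.presP e
    ; presLt = LEmb.presLt e
    }
  ; presC = LEmb.presC e
  }

FinModel-≡-dec : (N : FinModel) → DecidableEquality (Carrier (str N))
FinModel-≡-dec N = via-injection (↔⇒↣ (fin N)) _≟ᶠ_

module _ (M : ℕ → FinModel) where

  Const-≡-dec : DecidableEquality (Const M)
  Const-≡-dec = ≡-dec ℕ._≟_ (≡-dec ℕ._≟_ (FinModel-≡-dec (M _)))

  data ConstLt (k : ℕ) : Const M → Const M → Set where
    copyLt : ∀ {i j a b} → Lt (str (M i)) k a b → ConstLt k (i , j , a) (i , j , b)

  canonicalL0 : L0Str
  canonicalL0 = record
    { Carrier = Const M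
    ; P       = λ { k (i , _ , a) → P (str (M i)) k a }
    ; Lt      = ConstLt
    }

  canonical : LStr M
  canonical = record { base = canonicalL0 ; interp = λ c → c }

  canonical-allNamed : AllNamed canonical
  canonical-allNamed c = c , λ e → e

  canonical-isModelT0 : IsModelT0 canonicalL0
  canonical-isModelT0 = record
    { disjoint = λ { i i′ i≢i′ ((_ , _ , a) , p , p′) →
                     disjoint (model (M _)) i i′ i≢i′ (a , p , p′) }
    ; typed    = λ { k _ _ (copyLt a<b) → typed (model (M _)) k _ _ a<b }
    ; hasPred  = λ { k (i , j , a) p →
                     let (b , pb , b<a) = hasPred (model (M i)) k a p
                     in (i , j , b) , pb , copyLt b<a }
    ; uniqPred = λ { k _ _ _ (copyLt a<c) (copyLt b<c) →
                     cong (λ z → (_ , _ , z)) (uniqPred (model (M _)) k _ _ _ a<c b<c) }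
    }
    where open IsModelT0

  canonical-isModelT : IsModelT M canonical
  canonical-isModelT = record
    { t0       = canonical-isModelT0
    ; distinct = λ _ _ c≢d → c≢d
    ; diagP    = λ _ _ _ _ → mk⇔ (λ p → p) (λ p → p)
    ; diagLt   = λ _ _ _ _ _ → mk⇔ (λ { (copyLt a<b) → a<b }) copyLt
    ; closed   = λ { _ _ _ _ _ (inj₁ (copyLt _)) → _ , refl
                   ; _ _ _ _ _ (inj₂ (copyLt _)) → _ , refl }
    }

  module _ (D : LStr M) (D⊨T : IsModelT M D) where
    open IsModelT D⊨T

    interp-injective : Injective _≡_ _≡_ (interp D)
    interp-injective = ≢-preserving⇒injective Const-≡-dec distinct

    interp-presP : ∀ k c → P canonicalL0 k c ⇔ P (base D) k (interp D c)
    interp-presP k (i , j , a) = ⇔-sym (diagP i j k a)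

    interp-reflectsLt : ∀ k c d → Lt (base D) k (interp D c) (interp D d) → ConstLt k c d
    interp-reflectsLt k (i , j , a) d c<d
      with b , d≡b ← closed i j k a (interp D d) (inj₁ c<d)
      with refl ← interp-injective d≡b
      = copyLt (Equivalence.to (diagLt i j k a b) c<d)

    interp-presLt : ∀ k c d → ConstLt k c d ⇔ Lt (base D) k (interp D c) (interp D d)
    interp-presLt k c d = mk⇔ preserves (interp-reflectsLt k c d)
      where
        preserves : ConstLt k c d → Lt (base D) k (interp D c) (interp D d)
        preserves (copyLt a<b) = Equivalence.from (diagLt _ _ k _ _) a<b

    canonical-embeds : LEmb canonical D
    canonical-embeds = record
      { f      = interp D
      ; inj    = interp-injective
      ; presP  = interp-presP
      ; presLt = interp-presLt
      ; presC  = λ _ → refl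
      }

proposition4p2 : (M : ℕ → FinModel) → IsEnumeration M →
    Σ[ C ∈ LStr M ] (IsModelT M C × AllNamed C ×
      (∀ (D : LStr M) → IsModelT M D → AllNamed D → LIso C D) ×
      (∀ (D : LStr M) → IsModelT M D → LEmb C D))
proposition4p2 M _ =
  canonical M , canonical-isModelT M , canonical-allNamed M ,
  (λ D D⊨T D-named → LEmb⇒LIso (canonical-embeds M D D⊨T) D-named) ,
  canonical-embeds M
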